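{- Let $c>0$ be a constant such that $\tilde f(K_t)\leq (c+o(1))\,t^2$ as $t\to\infty$ (such a constant exists). Then for every integer $t\geq1$ and every graph $G$, if $\tilde\eta(G)\geq (2c+o(1))\,t^2$, then $G$ contains a bipartite subgraph $\hat G\subseteq G$ with $\tilde\eta(\hat G)\geq t$.
   Context: All graphs are finite and simple. A graph $H$ is a topological-minor of $G$ if some subgraph of $G$ is isomorphic to a subdivision of $H$. The Hajós number $\tilde\eta(G)$ is the maximum integer $t$ such that $K_t$ is a topological-minor of $G$. For a graph $H$, $\tilde f(H)$ is the infimum of all real numbers $d$ such that every graph with average degree at least $d$ contains $H$ as a topological-minor. The $o(1)$ terms denote functions of $t$ tending to $0$ as $t\to\infty$.
   Formalization: The constant c ranges over the positive rationals, and the o(1) term in the hypothesis on $\tilde f(K_t)$ takes rational values. -}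

module Defs where

open import Data.Nat as ℕ using (ℕ; suc)
open import Data.Nat.ListAction using (sum)
open import Data.Integer using (+_)
open import Data.Rational using (ℚ; _/_; _+_; _*_; _≤_; _<_; 0ℚ; ∣_∣)
open import Data.Bool using (Bool; true; false; if_then_else_)
open import Data.Fin as Fin using (Fin)
open import Data.Fin.Properties using (_<?_)
open import Data.List using (List; []; _∷_; _++_; map; concatMap; allFin; length)
open import Data.List.Relation.Unary.Unique.Propositional using (Unique)
open import Data.Product using (Σ; _×_; ∃-syntax)
open import Relation.Binary.PropositionalEquality using (_≡_; _≢_)
open import Relation.Nullary.Decidable using (⌊_⌋)

ℕ→ℚ : ℕ → ℚ
ℕ→ℚ n = + n / 1

record Graph : Set where
  field
    n     : ℕ
    adj   : Fin n → Fin n → Bool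
    sym   : ∀ u v → adj u v ≡ adj v u
    irrefl : ∀ v → adj v v ≡ false
open Graph public

degree : (G : Graph) → Fin (n G) → ℕ
degree G u = length (Data.List.filterᵇ (λ v → adj G u v) (allFin (n G)))

degreeSum : Graph → ℕ
degreeSum G = sum (map (degree G) (allFin (n G)))

-- "G has average degree at least d":  G has at least one vertex and
-- (sum of degrees) / |V(G)| ≥ d, i.e. d * |V(G)| ≤ sum of degrees.
AvgDegAtLeast : Graph → ℚ → Set
AvgDegAtLeast G d = (1 ℕ.≤ n G) × (d * ℕ→ℚ (n G) ≤ ℕ→ℚ (degreeSum G))

-- A walk a, x₁, …, x_k, b along edges of G (xs = interior vertices)
Walk : (G : Graph) → Fin (n G) → List (Fin (n G)) → Fin (n G) → Set
Walk G a []       b = adj G a b ≡ true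
Walk G a (x ∷ xs) b = (adj G a x ≡ true) × Walk G x xs b

interiors : {m t : ℕ} → (Fin t → Fin t → List (Fin m)) → List (Fin m)
interiors {t = t} P =
  concatMap (λ i → concatMap (λ j → if ⌊ i <? j ⌋ then P i j else []) (allFin t)) (allFin t)

-- A subdivision of K_t in G: branch vertices φ, and for each pair i < j a
-- path from φ i to φ j with interior vertex list P i j, such that all branch
-- vertices and all interior vertices are pairwise distinct (so the paths are
-- paths, internally disjoint, and avoid the branch vertices).
record TopMinorK (t : ℕ) (G : Graph) : Set where
  field
    φ     : Fin t → Fin (n G)
    P     : Fin t → Fin t → List (Fin (n G))
    walks : ∀ i j → i Fin.< j → Walk G (φ i) (P i j) (φ j)
    distinct : Unique (map φ (allFin t) ++ interiors P)

-- Hajós number η̃(G) ≥ x  (η̃(G) = max t with K_t a topological minor of G)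
HajosAtLeast : Graph → ℚ → Set
HajosAtLeast G x = ∃[ s ] (TopMinorK s G × (x ≤ ℕ→ℚ s))

-- f̃(K_t) ≤ x : every rational d > x is a valid threshold, i.e. every graph of
-- average degree at least d contains K_t as a topological minor.
-- (f̃ is the infimum of valid thresholds, and the set of valid thresholds is
-- upward closed, so f̃(K_t) ≤ x iff every d > x is valid; rationals suffice by density.)
ftildeKAtMost : ℕ → ℚ → Set
ftildeKAtMost t x = ∀ (d : ℚ) → x < d → ∀ (G : Graph) → AvgDegAtLeast G d → TopMinorK t G

TendsToZero : (ℕ → ℚ) → Set
TendsToZero g = ∀ (ε : ℚ) → 0ℚ < ε → ∃[ T ] (∀ t → T ℕ.≤ t → ∣ g t ∣ ≤ ε)

record BipartiteSubgraph (G : Graph) (Ĝ : Graph) : Set where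
  field
    sameV   : n Ĝ ≡ n G
    colour  : Fin (n Ĝ) → Bool
    bip     : ∀ u v → adj Ĝ u v ≡ true → colour u ≢ colour v
    sub     : ∀ u v → adj Ĝ u v ≡ true →
                adj G (Fin.cast sameV u) (Fin.cast sameV v) ≡ true

-- Take a subdivision of K_s in G with s ≥ (2c + o(1)) t².  Give every branch vertex a colour and colour
-- each subdivided path alternately, starting from the colour of its first end; the path is then properly
-- 2-coloured exactly when its parity agrees with the colours of its two ends.  Choosing the branch colours
-- greedily makes at least half of the s(s-1)/2 paths consistent, so the graph F on the branch vertices whose
-- edges are the consistent paths has average degree at least (s-1)/2 > (c + o(1)) t² and contains a
-- subdivision of K_t.  Replacing each edge of F by its path gives a subdivision of K_t in the bipartite
-- subgraph of G formed by the edges joining differently coloured vertices.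

module Submission where

open import Level using (Level)
open import Function using (_∘_)
open import Relation.Binary.PropositionalEquality
  using (_≡_; _≢_; refl; sym; trans; cong; cong₂; subst; subst₂; module ≡-Reasoning)
open import Relation.Nullary using (Dec; yes; no)
open import Relation.Nullary.Decidable using (⌊_⌋)
open import Data.Empty using (⊥; ⊥-elim)
open import Data.Product using (_×_; _,_; proj₁; proj₂; ∃-syntax; uncurry)
open import Data.Product.Properties using (≡-dec)
open import Data.Sum using (_⊎_; inj₁; inj₂; [_,_]′)
open import Data.Maybe using (Maybe; just; maybe)
open import Data.Bool using (Bool; true; false; not; _∧_; _xor_; if_then_else_)
import Data.Bool.Properties as Bool
open import Data.Nat as ℕ using (ℕ; zero; suc; z≤n; s≤s)
import Data.Nat.Properties as ℕ
import Data.Nat.Coprimality as Coprime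
open import Data.Nat.ListAction using (sum)
open import Algebra.Properties.CommutativeMonoid.Sum ℕ.+-0-commutativeMonoid
  using (sum-syntax; ∑-distrib-+; ∑-comm; sum-cong-≗)
open import Data.Integer as ℤ using (+_; -[1+_])
import Data.Integer.Properties as ℤ
open import Data.Rational using (ℚ; mkℚ; _+_; _*_; _-_; _<_; _≤_; -_; 0ℚ; 1ℚ; ½; ∣_∣; *≤*; nonNegative)
import Data.Rational.Properties as ℚ
open import Data.Rational.Solver using (module +-*-Solver)
open import Data.Fin as Fin using (Fin)
import Data.Fin.Properties as Fin
open import Data.Fin.Properties using (_<?_)
import Data.Vec.Functional as Vector
open import Data.List
  using ( List; []; _∷_; [_]; _++_; map; concatMap; length; upTo; downFrom; applyUpTo; tabulate; allFin
        ; reverse; find; filterᵇ)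
import Data.List.Properties as List
open import Data.List.Membership.Propositional using (_∈_; _∉_)
open import Data.List.Membership.Propositional.Properties
  using (∈-++⁺ˡ; ∈-++⁺ʳ; ∈-++⁻; ∈-map⁺; ∈-map⁻; ∈-allFin; ∈-upTo⁺; ∈-upTo⁻; ∈-downFrom⁻)
open import Data.List.Relation.Unary.Any using (here; there)
open import Data.List.Relation.Unary.All as All using ([]; _∷_)
import Data.List.Relation.Unary.All.Properties as All
open import Data.List.Relation.Unary.Unique.Propositional using (Unique; []; _∷_)
import Data.List.Relation.Unary.Unique.Propositional.Properties as Unique
open import Data.List.Relation.Binary.Disjoint.Propositional using (Disjoint)
open import Data.List.Relation.Binary.Subset.Propositional using (_⊆_)

open import Defs hiding (sym)

private variable
  a b c : Level
  A B C : Set a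

-- Lists

Unique-++⁻ˡ : ∀ {xs ys : List A} → Unique (xs ++ ys) → Unique xs
Unique-++⁻ˡ {xs = []}     _        = []
Unique-++⁻ˡ {xs = x ∷ xs} (px ∷ u) = All.++⁻ˡ xs px ∷ Unique-++⁻ˡ u

Unique-++⁻ʳ : ∀ xs {ys : List A} → Unique (xs ++ ys) → Unique ys
Unique-++⁻ʳ []       u        = u
Unique-++⁻ʳ (x ∷ xs) (_ ∷ u) = Unique-++⁻ʳ xs u

Unique-++⇒Disjoint : ∀ xs {ys : List A} → Unique (xs ++ ys) → Disjoint xs ys
Unique-++⇒Disjoint (x ∷ xs) (px ∷ u) (here refl , v∈ys) = All.lookup (All.++⁻ʳ xs px) v∈ys refl
Unique-++⇒Disjoint (x ∷ xs) (_ ∷ u)  (there v∈xs , v∈ys) = Unique-++⇒Disjoint xs u (v∈xs , v∈ys)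

Unique-∷⁺ : ∀ {x : A} {xs} → x ∉ xs → Unique xs → Unique (x ∷ xs)
Unique-∷⁺ {xs = xs} x∉xs u = All.tabulate (λ y∈xs x≡y → x∉xs (subst (_∈ xs) (sym x≡y) y∈xs)) ∷ u

Unique-map⇒injectiveOn : ∀ {f : A → B} {xs} → Unique (map f xs) →
                         ∀ {x y} → x ∈ xs → y ∈ xs → f x ≡ f y → x ≡ y
Unique-map⇒injectiveOn _        (here refl)  (here refl)  _ = refl
Unique-map⇒injectiveOn {f = f} (px ∷ _) (here refl)  (there y∈) e = ⊥-elim (All.lookup px (∈-map⁺ f y∈) e)
Unique-map⇒injectiveOn {f = f} (px ∷ _) (there x∈) (here refl)  e =
  ⊥-elim (All.lookup px (∈-map⁺ f x∈) (sym e))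
Unique-map⇒injectiveOn (_ ∷ u)  (there x∈) (there y∈) e = Unique-map⇒injectiveOn u x∈ y∈ e

Unique-map⁺-⊆ : ∀ {f : A → B} {xs ys} → Unique (map f xs) → ys ⊆ xs → Unique ys → Unique (map f ys)
Unique-map⁺-⊆ {ys = []}     _  _   _         = []
Unique-map⁺-⊆ {f = f} {ys = y ∷ ys} ux ys⊆xs (py ∷ uy) =
  Unique-∷⁺ fy∉ (Unique-map⁺-⊆ ux (ys⊆xs ∘ there) uy)
  where
  fy∉ : f y ∉ map f ys
  fy∉ fy∈ with z , z∈ , e ← ∈-map⁻ f fy∈ =
    All.lookup py z∈ (Unique-map⇒injectiveOn ux (ys⊆xs (here refl)) (ys⊆xs (there z∈)) e)

∈-concatMap⁺ : ∀ {f : A → List B} {xs x y} → x ∈ xs → y ∈ f x → y ∈ concatMap f xs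
∈-concatMap⁺ {xs = _ ∷ _}        (here refl) y∈ = ∈-++⁺ˡ y∈
∈-concatMap⁺ {f = f} {xs = z ∷ _} (there x∈)  y∈ = ∈-++⁺ʳ (f z) (∈-concatMap⁺ x∈ y∈)

∈-concatMap⁻ : ∀ {f : A → List B} xs {y} → y ∈ concatMap f xs → ∃[ x ] (x ∈ xs × y ∈ f x)
∈-concatMap⁻ {f = f} (z ∷ zs) y∈ with ∈-++⁻ (f z) y∈
... | inj₁ y∈fz = z , here refl , y∈fz
... | inj₂ y∈rest with x , x∈ , y∈fx ← ∈-concatMap⁻ zs y∈rest = x , there x∈ , y∈fx

Unique-concatMap⁺ : ∀ {f : A → List B} {xs} → Unique xs → (∀ {x} → x ∈ xs → Unique (f x)) →
                    (∀ {x x′} → x ∈ xs → x′ ∈ xs → x ≢ x′ → Disjoint (f x) (f x′)) →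
                    Unique (concatMap f xs)
Unique-concatMap⁺ {xs = []}     _        _  _ = []
Unique-concatMap⁺ {xs = z ∷ zs} (pz ∷ u) uf d =
  Unique.++⁺ (uf (here refl)) (Unique-concatMap⁺ u (uf ∘ there) (λ p q → d (there p) (there q)))
    λ (v∈fz , v∈rest) → let x , x∈ , v∈fx = ∈-concatMap⁻ zs v∈rest in
      d (here refl) (there x∈) (All.lookup pz x∈) (v∈fz , v∈fx)

Unique-concatMap⁻ : ∀ {f : A → List B} xs → Unique (concatMap f xs) → ∀ {x} → x ∈ xs → Unique (f x)
Unique-concatMap⁻ {f = f} (z ∷ zs) u (here refl) = Unique-++⁻ˡ u
Unique-concatMap⁻ {f = f} (z ∷ zs) u (there x∈)  = Unique-concatMap⁻ zs (Unique-++⁻ʳ (f z) u) x∈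

Unique-concatMap⇒sameBlock : ∀ {f : A → List B} xs → Unique (concatMap f xs) →
                             ∀ {x x′ y} → x ∈ xs → x′ ∈ xs → y ∈ f x → y ∈ f x′ → x ≡ x′
Unique-concatMap⇒sameBlock (z ∷ zs) u (here refl) (here refl) _ _ = refl
Unique-concatMap⇒sameBlock {f = f} (z ∷ zs) u (here refl) (there x′∈) p q =
  ⊥-elim (Unique-++⇒Disjoint (f z) u (p , ∈-concatMap⁺ x′∈ q))
Unique-concatMap⇒sameBlock {f = f} (z ∷ zs) u (there x∈) (here refl) p q =
  ⊥-elim (Unique-++⇒Disjoint (f z) u (q , ∈-concatMap⁺ x∈ p))
Unique-concatMap⇒sameBlock {f = f} (z ∷ zs) u (there x∈) (there x′∈) p q =
  Unique-concatMap⇒sameBlock zs (Unique-++⁻ʳ (f z) u) x∈ x′∈ p q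

lefts : List (A ⊎ B) → List A
lefts []           = []
lefts (inj₁ x ∷ l) = x ∷ lefts l
lefts (inj₂ _ ∷ l) = lefts l

rights : List (A ⊎ B) → List B
rights []           = []
rights (inj₁ _ ∷ l) = rights l
rights (inj₂ y ∷ l) = y ∷ rights l

∈-lefts : ∀ {l : List (A ⊎ B)} {x} → inj₁ x ∈ l → x ∈ lefts l
∈-lefts {l = inj₁ _ ∷ _} (here refl) = here refl
∈-lefts {l = inj₁ _ ∷ _} (there p)   = there (∈-lefts p)
∈-lefts {l = inj₂ _ ∷ _} (there p)   = ∈-lefts p

∈-rights : ∀ {l : List (A ⊎ B)} {y} → inj₂ y ∈ l → y ∈ rights l
∈-rights {l = inj₂ _ ∷ _} (here refl) = here refl
∈-rights {l = inj₂ _ ∷ _} (there p)   = there (∈-rights p)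
∈-rights {l = inj₁ _ ∷ _} (there p)   = ∈-rights p

Unique-lefts-rights⇒Unique : ∀ {l : List (A ⊎ B)} → Unique (lefts l) → Unique (rights l) → Unique l
Unique-lefts-rights⇒Unique {l = []}         _          _          = []
Unique-lefts-rights⇒Unique {l = inj₁ x ∷ l} ul@(_ ∷ ul′) ur =
  Unique-∷⁺ (Unique.Unique[x∷xs]⇒x∉xs ul ∘ ∈-lefts) (Unique-lefts-rights⇒Unique ul′ ur)
Unique-lefts-rights⇒Unique {l = inj₂ y ∷ l} ul ur@(_ ∷ ur′) =
  Unique-∷⁺ (Unique.Unique[x∷xs]⇒x∉xs ur ∘ ∈-rights) (Unique-lefts-rights⇒Unique ul ur′)

lefts-++ : (l m : List (A ⊎ B)) → lefts (l ++ m) ≡ lefts l ++ lefts m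
lefts-++ []           m = refl
lefts-++ (inj₁ x ∷ l) m = cong (x ∷_) (lefts-++ l m)
lefts-++ (inj₂ _ ∷ l) m = lefts-++ l m

rights-++ : (l m : List (A ⊎ B)) → rights (l ++ m) ≡ rights l ++ rights m
rights-++ []           m = refl
rights-++ (inj₁ _ ∷ l) m = rights-++ l m
rights-++ (inj₂ y ∷ l) m = cong (y ∷_) (rights-++ l m)

lefts-concatMap : (f : C → List (A ⊎ B)) (xs : List C) → lefts (concatMap f xs) ≡ concatMap (lefts ∘ f) xs
lefts-concatMap f []       = refl
lefts-concatMap f (x ∷ xs) = trans (lefts-++ (f x) _) (cong (lefts (f x) ++_) (lefts-concatMap f xs))

rights-concatMap : (f : C → List (A ⊎ B)) (xs : List C) → rights (concatMap f xs) ≡ concatMap (rights ∘ f) xs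
rights-concatMap f []       = refl
rights-concatMap f (x ∷ xs) = trans (rights-++ (f x) _) (cong (rights (f x) ++_) (rights-concatMap f xs))

lefts-map-inj₁ : (xs : List A) → lefts {B = B} (map inj₁ xs) ≡ xs
lefts-map-inj₁ []       = refl
lefts-map-inj₁ (x ∷ xs) = cong (x ∷_) (lefts-map-inj₁ xs)

rights-map-inj₁ : (xs : List A) → rights {B = B} (map inj₁ xs) ≡ []
rights-map-inj₁ []       = refl
rights-map-inj₁ (_ ∷ xs) = rights-map-inj₁ xs

lefts-map-inj₂ : (xs : List B) → lefts {A = A} (map inj₂ xs) ≡ []
lefts-map-inj₂ []       = refl
lefts-map-inj₂ (_ ∷ xs) = lefts-map-inj₂ xs

rights-map-inj₂ : (xs : List B) → rights {A = A} (map inj₂ xs) ≡ xs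
rights-map-inj₂ []       = refl
rights-map-inj₂ (y ∷ xs) = cong (y ∷_) (rights-map-inj₂ xs)

consecutive : List A → List (A × A)
consecutive (x ∷ y ∷ l) = (x , y) ∷ consecutive (y ∷ l)
consecutive _           = []

∈-consecutive⁻ : ∀ {l : List A} {x y} → (x , y) ∈ consecutive l → x ∈ l × y ∈ l
∈-consecutive⁻ {l = _ ∷ _ ∷ _} (here refl) = here refl , there (here refl)
∈-consecutive⁻ {l = _ ∷ y ∷ l} (there p)   =
  let x∈ , y∈ = ∈-consecutive⁻ {l = y ∷ l} p in there x∈ , there y∈

Unique⇒consecutive-≢ : ∀ {l : List A} → Unique l → ∀ {x y} → (x , y) ∈ consecutive l → x ≢ y
Unique⇒consecutive-≢ {l = _ ∷ _ ∷ _} (px ∷ _) (here refl) = All.lookup px (here refl)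
Unique⇒consecutive-≢ {l = _ ∷ _ ∷ _} (_ ∷ u)  (there p)   = Unique⇒consecutive-≢ u p

nthOr : A → List A → ℕ → A
nthOr d []       _       = d
nthOr d (x ∷ xs) zero    = x
nthOr d (x ∷ xs) (suc m) = nthOr d xs m

map-nthOr-upTo : (d : A) (xs : List A) → map (nthOr d xs) (upTo (length xs)) ≡ xs
map-nthOr-upTo d xs = trans (List.map-upTo (nthOr d xs) (length xs)) (applyUpTo-nthOr xs)
  where
  applyUpTo-nthOr : ∀ xs → applyUpTo (nthOr d xs) (length xs) ≡ xs
  applyUpTo-nthOr []       = refl
  applyUpTo-nthOr (x ∷ xs) = cong (x ∷_) (applyUpTo-nthOr xs)

map-nthOr-downFrom : (d : A) (xs : List A) → map (nthOr d xs) (downFrom (length xs)) ≡ reverse xs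
map-nthOr-downFrom d xs = begin
  map (nthOr d xs) (downFrom (length xs))           ≡⟨ cong (map _) (List.reverse-upTo (length xs)) ⟨
  map (nthOr d xs) (reverse (upTo (length xs)))     ≡⟨ List.reverse-map (nthOr d xs) (upTo (length xs)) ⟩
  reverse (map (nthOr d xs) (upTo (length xs)))     ≡⟨ cong reverse (map-nthOr-upTo d xs) ⟩
  reverse xs                                        ∎
  where open ≡-Reasoning

module _ {L : Set a} {X : Set b} (_≟_ : (x y : X) → Dec (x ≡ y)) (f : L → X) where

  preimage : List L → X → Maybe L
  preimage ls y = find (λ l → f l ≟ y) ls

  preimage-correct : ∀ ls → Unique (map f ls) → ∀ {l} → l ∈ ls → preimage ls (f l) ≡ just l
  preimage-correct (k ∷ ls) _ (here refl) with f k ≟ f k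
  ... | yes _   = refl
  ... | no f≢f = ⊥-elim (f≢f refl)
  preimage-correct (k ∷ ls) (pk ∷ u) {l} (there l∈) with f k ≟ f l
  ... | yes e = ⊥-elim (All.lookup pk (∈-map⁺ f l∈) e)
  ... | no _  = preimage-correct ls u l∈

concatMap-concatMap : (f : B → List C) (g : A → List B) (xs : List A) →
                      concatMap f (concatMap g xs) ≡ concatMap (concatMap f ∘ g) xs
concatMap-concatMap f g []       = refl
concatMap-concatMap f g (x ∷ xs) =
  trans (List.concatMap-++ f (g x) _) (cong (concatMap f (g x) ++_) (concatMap-concatMap f g xs))

guarded : Bool → A → List A
guarded b x = if b then [ x ] else []

∈-guarded⁻ : ∀ {b} {x y : A} → y ∈ guarded b x → y ≡ x × b ≡ true
∈-guarded⁻ {b = true} (here refl) = refl , refl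

Unique-guarded : ∀ b (x : A) → Unique (guarded b x)
Unique-guarded true  _ = [] ∷ []
Unique-guarded false _ = []

pairs : (t : ℕ) → List (Fin t × Fin t)
pairs t = concatMap (λ i → concatMap (λ j → guarded ⌊ i <? j ⌋ (i , j)) (allFin t)) (allFin t)

interiors-pairs : ∀ {m t} (P : Fin t → Fin t → List (Fin m)) →
                  interiors P ≡ concatMap (uncurry P) (pairs t)
interiors-pairs {t = t} P = sym (begin
  concatMap (uncurry P) (pairs t)
    ≡⟨ concatMap-concatMap (uncurry P) _ (allFin t) ⟩
  concatMap (λ i → concatMap (uncurry P) (concatMap (λ j → guarded ⌊ i <? j ⌋ (i , j)) (allFin t))) (allFin t)
    ≡⟨ List.concatMap-cong (λ i → concatMap-concatMap (uncurry P) _ (allFin t)) (allFin t) ⟩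
  concatMap (λ i → concatMap (λ j → concatMap (uncurry P) (guarded ⌊ i <? j ⌋ (i , j))) (allFin t)) (allFin t)
    ≡⟨ List.concatMap-cong (λ i → List.concatMap-cong (λ j → concatMap-guarded ⌊ i <? j ⌋) (allFin t))
                           (allFin t) ⟩
  interiors P ∎)
  where
  open ≡-Reasoning
  concatMap-guarded : ∀ {i j} b → concatMap (uncurry P) (guarded b (i , j)) ≡ (if b then P i j else [])
  concatMap-guarded true  = List.++-identityʳ _
  concatMap-guarded false = refl

∈-pairs⁻ : ∀ {t} {i j : Fin t} → (i , j) ∈ pairs t → i Fin.< j
∈-pairs⁻ {t} p with i′ , _ , q ← ∈-concatMap⁻ (allFin t) p
               with j′ , _ , r ← ∈-concatMap⁻ (allFin t) q
               with i′ <? j′ | ∈-guarded⁻ r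
... | yes i′<j′ | refl , _ = i′<j′

∈-pairs⁺ : ∀ {t} {i j : Fin t} → i Fin.< j → (i , j) ∈ pairs t
∈-pairs⁺ {t} {i} {j} i<j = ∈-concatMap⁺ (∈-allFin i) (∈-concatMap⁺ (∈-allFin j) (∈-guarded⁺ (i <? j)))
  where
  ∈-guarded⁺ : (d : Dec (i Fin.< j)) → (i , j) ∈ guarded ⌊ d ⌋ (i , j)
  ∈-guarded⁺ (yes _)  = here refl
  ∈-guarded⁺ (no i≮j) = ⊥-elim (i≮j i<j)

Unique-pairs : ∀ t → Unique (pairs t)
Unique-pairs t = Unique-concatMap⁺ (Unique.allFin⁺ t)
  (λ {i} _ → Unique-concatMap⁺ (Unique.allFin⁺ t) (λ {j} _ → Unique-guarded ⌊ i <? j ⌋ (i , j))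
     λ _ _ j≢j′ (p , q) → j≢j′ (trans (sym (second p)) (second q)))
  λ _ _ i≢i′ (p , q) → i≢i′ (trans (sym (first p)) (first q))
  where
  second : ∀ {i j} {p : Fin t × Fin t} → p ∈ guarded ⌊ i <? j ⌋ (i , j) → proj₂ p ≡ j
  second p∈ = cong proj₂ (proj₁ (∈-guarded⁻ p∈))

  first : ∀ {i} {p : Fin t × Fin t} → p ∈ concatMap (λ j → guarded ⌊ i <? j ⌋ (i , j)) (allFin t) →
          proj₁ p ≡ i
  first p∈ with _ , _ , q ← ∈-concatMap⁻ (allFin t) p∈ = cong proj₁ (proj₁ (∈-guarded⁻ q))

-- Degree sums and a greedy 2-colouring

indicator : Bool → ℕ
indicator true  = 1
indicator false = 0

_==_ : Bool → Bool → Bool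
x == y = not (x xor y)

==⇒≡ : ∀ {x y} → (x == y) ≡ true → x ≡ y
==⇒≡ {false} {false} _ = refl
==⇒≡ {true}  {true}  _ = refl

sum-tabulate : ∀ {n} (f : Fin n → ℕ) → sum (tabulate f) ≡ ∑[ i < n ] f i
sum-tabulate {zero}  f = refl
sum-tabulate {suc n} f = cong (f Fin.zero ℕ.+_) (sum-tabulate (f ∘ Fin.suc))

length-filterᵇ : (p : A → Bool) (xs : List A) → length (filterᵇ p xs) ≡ sum (map (indicator ∘ p) xs)
length-filterᵇ p []       = refl
length-filterᵇ p (x ∷ xs) with p x
... | true  = cong suc (length-filterᵇ p xs)
... | false = length-filterᵇ p xs

degreeSum≡∑∑ : ∀ G → degreeSum G ≡ ∑[ u < n G ] ∑[ v < n G ] indicator (adj G u v)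
degreeSum≡∑∑ G = begin
  sum (map (degree G) (allFin (n G)))      ≡⟨ cong sum (List.map-tabulate (λ u → u) (degree G)) ⟩
  sum (tabulate (degree G))                ≡⟨ sum-tabulate (degree G) ⟩
  ∑[ u < n G ] degree G u                  ≡⟨ sum-cong-≗ degree≡∑ ⟩
  ∑[ u < n G ] ∑[ v < n G ] indicator (adj G u v) ∎
  where
  open ≡-Reasoning
  degree≡∑ : ∀ u → degree G u ≡ ∑[ v < n G ] indicator (adj G u v)
  degree≡∑ u = begin
    length (filterᵇ (adj G u) (allFin (n G)))     ≡⟨ length-filterᵇ (adj G u) (allFin (n G)) ⟩
    sum (map (indicator ∘ adj G u) (allFin (n G)))
      ≡⟨ cong sum (List.map-tabulate (λ v → v) (indicator ∘ adj G u)) ⟩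
    sum (tabulate (indicator ∘ adj G u))           ≡⟨ sum-tabulate (indicator ∘ adj G u) ⟩
    ∑[ v < n G ] indicator (adj G u v)             ∎

_<ᵇ_ : ∀ {n} → Fin n → Fin n → Bool
Fin.zero  <ᵇ Fin.zero  = false
Fin.zero  <ᵇ Fin.suc _ = true
Fin.suc _ <ᵇ Fin.zero  = false
Fin.suc i <ᵇ Fin.suc j = i <ᵇ j

<ᵇ⇒< : ∀ {n} (i j : Fin n) → (i <ᵇ j) ≡ true → i Fin.< j
<ᵇ⇒< Fin.zero    (Fin.suc j) _ = s≤s z≤n
<ᵇ⇒< (Fin.suc i) (Fin.suc j) e = s≤s (<ᵇ⇒< i j e)

<ᵇ-irrefl : ∀ {n} (i : Fin n) → (i <ᵇ i) ≡ false
<ᵇ-irrefl Fin.zero    = refl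
<ᵇ-irrefl (Fin.suc i) = <ᵇ-irrefl i

<ᵇ-asym : ∀ {n} (i j : Fin n) → (i <ᵇ j) ≡ true → (j <ᵇ i) ≡ true → ⊥
<ᵇ-asym Fin.zero    (Fin.suc j) _ ()
<ᵇ-asym (Fin.suc i) (Fin.suc j) e f = <ᵇ-asym i j e f

<ᵇ-connex : ∀ {n} (i j : Fin n) → (i <ᵇ j) ≡ false → (j <ᵇ i) ≡ false → i ≡ j
<ᵇ-connex Fin.zero    Fin.zero    _ _ = refl
<ᵇ-connex (Fin.suc i) (Fin.suc j) e f = cong Fin.suc (<ᵇ-connex i j e f)

module _ {s : ℕ} (R : Fin s → Fin s → Bool) where

  pairAdj : Fin s → Fin s → Bool
  pairAdj i j = if i <ᵇ j then R i j else if j <ᵇ i then R j i else false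

  pairGraph : Graph
  pairGraph = record
    { n      = s
    ; adj    = pairAdj
    ; sym    = pairAdj-sym
    ; irrefl = λ i → cong (λ b → if b then R i i else if b then R i i else false) (<ᵇ-irrefl i)
    }
    where
    pairAdj-sym : ∀ i j → pairAdj i j ≡ pairAdj j i
    pairAdj-sym i j with i <ᵇ j in e | j <ᵇ i in f
    ... | true  | true  = ⊥-elim (<ᵇ-asym i j e f)
    ... | true  | false = refl
    ... | false | true  = refl
    ... | false | false = refl

  upperCount : ℕ
  upperCount = ∑[ i < s ] ∑[ j < s ] indicator ((i <ᵇ j) ∧ R i j)

  degreeSum-pairGraph : degreeSum pairGraph ≡ upperCount ℕ.+ upperCount
  degreeSum-pairGraph = begin
    degreeSum pairGraph                                 ≡⟨ degreeSum≡∑∑ pairGraph ⟩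
    ∑[ i < s ] ∑[ j < s ] indicator (pairAdj i j)       ≡⟨ sum-cong-≗ (sum-cong-≗ ∘ indicator-pairAdj) ⟩
    ∑[ i < s ] ∑[ j < s ] (M i j ℕ.+ M j i)
      ≡⟨ sum-cong-≗ (λ i → ∑-distrib-+ (M i) (λ j → M j i)) ⟩
    ∑[ i < s ] (∑[ j < s ] M i j ℕ.+ ∑[ j < s ] M j i)
      ≡⟨ ∑-distrib-+ (λ i → ∑[ j < s ] M i j) _ ⟩
    upperCount ℕ.+ ∑[ i < s ] ∑[ j < s ] M j i
      ≡⟨ cong (upperCount ℕ.+_) (∑-comm (λ i j → M j i)) ⟩
    upperCount ℕ.+ upperCount                           ∎
    where
    open ≡-Reasoning
    M : Fin s → Fin s → ℕ
    M i j = indicator ((i <ᵇ j) ∧ R i j)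
    indicator-pairAdj : ∀ i j → indicator (pairAdj i j) ≡ M i j ℕ.+ M j i
    indicator-pairAdj i j with i <ᵇ j in e | j <ᵇ i in f
    ... | true  | true  = ⊥-elim (<ᵇ-asym i j e f)
    ... | true  | false = sym (ℕ.+-identityʳ _)
    ... | false | true  = refl
    ... | false | false = refl

triangular : ℕ → ℕ
triangular zero    = 0
triangular (suc s) = s ℕ.+ triangular s

satisfied : ∀ {s} → (Fin s → Bool) → (Fin s → Fin s → Bool) → Fin s → Fin s → Bool
satisfied x π i j = x j == (x i xor π i j)

n+n≡2*n : ∀ m → m ℕ.+ m ≡ 2 ℕ.* m
n+n≡2*n m = cong (m ℕ.+_) (sym (ℕ.+-identityʳ m))

+-≤-2*-either : ∀ m k → m ℕ.+ k ℕ.≤ 2 ℕ.* m ⊎ m ℕ.+ k ℕ.≤ 2 ℕ.* k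
+-≤-2*-either m k with ℕ.≤-total k m
... | inj₁ k≤m = inj₁ (subst (m ℕ.+ k ℕ.≤_) (n+n≡2*n m) (ℕ.+-monoʳ-≤ m k≤m))
... | inj₂ m≤k = inj₂ (subst (m ℕ.+ k ℕ.≤_) (n+n≡2*n k) (ℕ.+-monoˡ-≤ k m≤k))

-- The colour of vertex 0 is chosen last, so that at least half of its constraints are satisfied.
halfSatisfiable : ∀ s (π : Fin s → Fin s → Bool) →
                  ∃[ x ] triangular s ℕ.≤ 2 ℕ.* upperCount (satisfied x π)
halfSatisfiable zero    π = (λ ()) , z≤n
halfSatisfiable (suc s) π
  with x , ih ← halfSatisfiable s (λ i j → π (Fin.suc i) (Fin.suc j)) = x₀ Vector.∷ x , bound
  where
  colouredAt0 : Bool → Fin s → ℕ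
  colouredAt0 x₀ j = indicator (satisfied (x₀ Vector.∷ x) π Fin.zero (Fin.suc j))

  satisfiedAt0 : Bool → ℕ
  satisfiedAt0 x₀ = ∑[ j < s ] colouredAt0 x₀ j

  exactlyOneColour : ∀ c y → indicator (y == (true xor c)) ℕ.+ indicator (y == (false xor c)) ≡ 1
  exactlyOneColour false false = refl
  exactlyOneColour false true  = refl
  exactlyOneColour true  false = refl
  exactlyOneColour true  true  = refl

  satisfiedAt0-total : satisfiedAt0 true ℕ.+ satisfiedAt0 false ≡ s
  satisfiedAt0-total = begin
    satisfiedAt0 true ℕ.+ satisfiedAt0 false  ≡⟨ ∑-distrib-+ (colouredAt0 true) (colouredAt0 false) ⟨
    ∑[ j < s ] (colouredAt0 true j ℕ.+ colouredAt0 false j)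
      ≡⟨ sum-cong-≗ (λ j → exactlyOneColour (π Fin.zero (Fin.suc j)) (x j)) ⟩
    ∑[ j < s ] 1                              ≡⟨ ∑-const-1 s ⟩
    s                                         ∎
    where
    open ≡-Reasoning
    ∑-const-1 : ∀ s → ∑[ j < s ] 1 ≡ s
    ∑-const-1 zero    = refl
    ∑-const-1 (suc s) = cong suc (∑-const-1 s)

  x₀ : Bool
  x₀ = [ (λ _ → true) , (λ _ → false) ]′ (+-≤-2*-either (satisfiedAt0 true) (satisfiedAt0 false))

  x₀-good : s ℕ.≤ 2 ℕ.* satisfiedAt0 x₀
  x₀-good with +-≤-2*-either (satisfiedAt0 true) (satisfiedAt0 false)
  ... | inj₁ le = subst (ℕ._≤ 2 ℕ.* satisfiedAt0 true) satisfiedAt0-total le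
  ... | inj₂ le = subst (ℕ._≤ 2 ℕ.* satisfiedAt0 false) satisfiedAt0-total le

  -- upperCount on s + 1 vertices unfolds to the row of vertex 0 plus upperCount on the other s.
  bound : triangular (suc s) ℕ.≤ 2 ℕ.* upperCount (satisfied (x₀ Vector.∷ x) π)
  bound = subst (triangular (suc s) ℕ.≤_) (sym (ℕ.*-distribˡ-+ 2 (satisfiedAt0 x₀) _))
                (ℕ.+-mono-≤ x₀-good ih)

-- Crossing subgraphs and branch paths

odd : ℕ → Bool
odd zero    = false
odd (suc m) = not (odd m)

Alternating : (ℕ → Bool) → Set
Alternating κ = ∀ m → κ (suc m) ≡ not (κ m)

module _ (H : Graph) where

  Walk-++ : ∀ {a m b} xs ys → Walk H a xs m → Walk H m ys b → Walk H a (xs ++ m ∷ ys) b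
  Walk-++ []       ys am       mb = am , mb
  Walk-++ (x ∷ xs) ys (ax , w) mb = ax , Walk-++ xs ys w mb

  Walk-reverse : ∀ {a b} xs → Walk H a xs b → Walk H b (reverse xs) a
  Walk-reverse {a} {b} []       ab       = trans (Graph.sym H b a) ab
  Walk-reverse {a} {b} (x ∷ xs) (ax , w) =
    subst (λ ys → Walk H b ys a) (sym (List.unfold-reverse x xs))
      (Walk-++ (reverse xs) [] (Walk-reverse xs w) (trans (Graph.sym H x a) ax))

∧≡true⁻ : ∀ {x y} → (x ∧ y) ≡ true → x ≡ true × y ≡ true
∧≡true⁻ {true} {true} _ = refl , refl

xor≡true⇒≢ : ∀ {x y} → (x xor y) ≡ true → x ≢ y
xor≡true⇒≢ {false} {false} ()
xor≡true⇒≢ {true}  {true}  ()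
xor≡true⇒≢ {false} {true}  _ ()
xor≡true⇒≢ {true}  {false} _ ()

module _ (G : Graph) (colour : Fin (n G) → Bool) where

  crossingAdj : Fin (n G) → Fin (n G) → Bool
  crossingAdj u v = adj G u v ∧ (colour u xor colour v)

  crossingSubgraph : Graph
  crossingSubgraph = record
    { n      = n G
    ; adj    = crossingAdj
    ; sym    = λ u v → cong₂ _∧_ (Graph.sym G u v) (Bool.xor-comm (colour u) (colour v))
    ; irrefl = λ v → cong (_∧ (colour v xor colour v)) (irrefl G v)
    }

  crossingSubgraph-bipartite : BipartiteSubgraph G crossingSubgraph
  crossingSubgraph-bipartite = record
    { sameV  = refl
    ; colour = colour
    ; bip    = λ u v uv → xor≡true⇒≢ (proj₂ (∧≡true⁻ uv))
    ; sub    = λ u v uv → subst₂ (λ u′ v′ → adj G u′ v′ ≡ true)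
                            (sym (Fin.cast-is-id refl u)) (sym (Fin.cast-is-id refl v)) (proj₁ (∧≡true⁻ uv))
    }

  crossingAdj-intro : ∀ {u v} → adj G u v ≡ true → colour v ≡ not (colour u) → crossingAdj u v ≡ true
  crossingAdj-intro {u} uv cv = subst (λ c → adj G u _ ∧ (colour u xor c) ≡ true) (sym cv)
    (cong₂ _∧_ uv (xor-not-self (colour u)))
    where
    xor-not-self : ∀ x → (x xor not x) ≡ true
    xor-not-self false = refl
    xor-not-self true  = refl

  Walk-crossing : ∀ {a b} (d : Fin (n G)) xs (κ : ℕ → Bool) → Alternating κ → Walk G a xs b →
                  colour a ≡ κ 0 →
                  (∀ m → m ℕ.< length xs → colour (nthOr d xs m) ≡ κ (suc m)) →
                  colour b ≡ κ (suc (length xs)) →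
                  Walk crossingSubgraph a xs b
  Walk-crossing d []       κ alt ab       ca _    cb =
    crossingAdj-intro ab (trans cb (trans (alt 0) (cong not (sym ca))))
  Walk-crossing d (y ∷ ys) κ alt (ay , w) ca cint cb =
    crossingAdj-intro ay (trans (cint 0 (s≤s z≤n)) (trans (alt 0) (cong not (sym ca)))) ,
    Walk-crossing d ys (κ ∘ suc) (alt ∘ suc) w (cint 0 (s≤s z≤n)) (λ m m< → cint (suc m) (s≤s m<)) cb

edgeKey : ∀ {n} → Fin n × Fin n → Fin n × Fin n
edgeKey (u , v) = if u <ᵇ v then (u , v) else (v , u)

SameEnds : ∀ {n} → Fin n × Fin n → Fin n × Fin n → Set
SameEnds (u , v) (u′ , v′) = (u ≡ u′ × v ≡ v′) ⊎ (u ≡ v′ × v ≡ u′)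

edgeKey-injective : ∀ {n} (e e′ : Fin n × Fin n) → edgeKey e ≡ edgeKey e′ → SameEnds e e′
edgeKey-injective (u , v) (u′ , v′) eq with u <ᵇ v | u′ <ᵇ v′
... | true  | true  = inj₁ (cong proj₁ eq , cong proj₂ eq)
... | true  | false = inj₂ (cong proj₁ eq , cong proj₂ eq)
... | false | true  = inj₂ (cong proj₂ eq , cong proj₁ eq)
... | false | false = inj₁ (cong proj₂ eq , cong proj₁ eq)

edgeKey-swap : ∀ {n} (u v : Fin n) → u ≢ v → edgeKey (v , u) ≡ edgeKey (u , v)
edgeKey-swap u v u≢v with u <ᵇ v in e | v <ᵇ u in f
... | true  | true  = ⊥-elim (<ᵇ-asym u v e f)
... | true  | false = refl
... | false | true  = refl
... | false | false = ⊥-elim (u≢v (<ᵇ-connex u v e f))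

edgeKey-within : ∀ {n} {u v y y′ : Fin n} → y ≢ y′ → y ≡ u ⊎ y ≡ v → y′ ≡ u ⊎ y′ ≡ v →
                 edgeKey (y , y′) ≡ edgeKey (u , v)
edgeKey-within y≢y′ (inj₁ refl) (inj₁ refl) = ⊥-elim (y≢y′ refl)
edgeKey-within y≢y′ (inj₁ refl) (inj₂ refl) = refl
edgeKey-within y≢y′ (inj₂ refl) (inj₁ refl) = edgeKey-swap _ _ (y≢y′ ∘ sym)
edgeKey-within y≢y′ (inj₂ refl) (inj₂ refl) = ⊥-elim (y≢y′ refl)

Unique-edgeKeys : ∀ {n} {l : List (Fin n)} → Unique l → Unique (map edgeKey (consecutive l))
Unique-edgeKeys {l = []}        _ = []
Unique-edgeKeys {l = _ ∷ []}    _ = []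
Unique-edgeKeys {l = x ∷ y ∷ l} (px ∷ u) = Unique-∷⁺ repeated (Unique-edgeKeys u)
  where
  repeated : edgeKey (x , y) ∉ map edgeKey (consecutive (y ∷ l))
  repeated k∈ with e , e∈ , eq ← ∈-map⁻ edgeKey k∈
                 with e₁∈ , e₂∈ ← ∈-consecutive⁻ {l = y ∷ l} e∈
                 with edgeKey-injective (x , y) e eq
  ... | inj₁ (x≡e₁ , _) = All.lookup px (subst (_∈ y ∷ l) (sym x≡e₁) e₁∈) refl
  ... | inj₂ (x≡e₂ , _) = All.lookup px (subst (_∈ y ∷ l) (sym x≡e₂) e₂∈) refl

module BranchPaths {t : ℕ} {H : Graph} (K : TopMinorK t H) where
  open TopMinorK K

  branchPath : Fin t × Fin t → List (Fin (n H))
  branchPath p = φ (proj₁ p) ∷ uncurry P p ++ [ φ (proj₂ p) ]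

  Unique-vertices : Unique (map φ (allFin t) ++ concatMap (uncurry P) (pairs t))
  Unique-vertices = subst (λ l → Unique (map φ (allFin t) ++ l)) (interiors-pairs P) distinct

  Unique-interiors : Unique (concatMap (uncurry P) (pairs t))
  Unique-interiors = Unique-++⁻ʳ (map φ (allFin t)) Unique-vertices

  φ-injective : ∀ {i j} → φ i ≡ φ j → i ≡ j
  φ-injective = Unique-map⇒injectiveOn (Unique-++⁻ˡ Unique-vertices) (∈-allFin _) (∈-allFin _)

  φ∉interior : ∀ {i p} → p ∈ pairs t → φ i ∉ uncurry P p
  φ∉interior p∈ φi∈ =
    Unique-++⇒Disjoint (map φ (allFin t)) Unique-vertices (∈-map⁺ φ (∈-allFin _) , ∈-concatMap⁺ p∈ φi∈)

  Unique-branchPath : ∀ {p} → p ∈ pairs t → Unique (branchPath p)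
  Unique-branchPath {p} p∈ =
    Unique-∷⁺ start∉ (Unique.++⁺ (Unique-concatMap⁻ (pairs t) Unique-interiors p∈) ([] ∷ [])
      λ { (y∈ , here refl) → φ∉interior p∈ y∈ })
    where
    start∉ : φ (proj₁ p) ∉ uncurry P p ++ [ φ (proj₂ p) ]
    start∉ φi∈ with ∈-++⁻ (uncurry P p) φi∈
    ... | inj₁ φi∈P          = φ∉interior p∈ φi∈P
    ... | inj₂ (here φi≡φj) = Fin.<-irrefl (φ-injective φi≡φj) (∈-pairs⁻ p∈)

  EndOf : Fin t × Fin t → Fin (n H) → Set
  EndOf p y = y ≡ φ (proj₁ p) ⊎ y ≡ φ (proj₂ p)

  branchPaths-meetAtEnds : ∀ {p p′ y} → p ∈ pairs t → p′ ∈ pairs t → p ≢ p′ →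
                           y ∈ branchPath p → y ∈ branchPath p′ → EndOf p y
  branchPaths-meetAtEnds _ _ _ (here y≡φi) _ = inj₁ y≡φi
  branchPaths-meetAtEnds {p} {p′} {y} p∈ p′∈ p≢p′ (there y∈) y∈′ with ∈-++⁻ (uncurry P p) y∈
  ... | inj₂ (here y≡φj) = inj₂ y≡φj
  ... | inj₁ y∈P         = ⊥-elim (interior∉ y∈′)
    where
    interior∉ : y ∉ branchPath p′
    interior∉ (here refl) = φ∉interior p∈ y∈P
    interior∉ (there y∈′) with ∈-++⁻ (uncurry P p′) y∈′
    ... | inj₁ y∈P′        =
      p≢p′ (Unique-concatMap⇒sameBlock (pairs t) Unique-interiors p∈ p′∈ y∈P y∈P′)
    ... | inj₂ (here refl) = φ∉interior p∈ y∈P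

  ends : Fin t × Fin t → Fin (n H) × Fin (n H)
  ends p = φ (proj₁ p) , φ (proj₂ p)

  sharedEdge⇒sameEnds : ∀ {p p′ e e′} → p ∈ pairs t → p′ ∈ pairs t → p ≢ p′ →
                        e ∈ consecutive (branchPath p) → e′ ∈ consecutive (branchPath p′) →
                        edgeKey e ≡ edgeKey e′ → SameEnds (ends p) (ends p′)
  sharedEdge⇒sameEnds {p} {p′} {e₁ , e₂} {e′} p∈ p′∈ p≢p′ e∈ e′∈ eq =
    edgeKey-injective (ends p) (ends p′)
      (trans (sym (key p∈ p′∈ p≢p′ (∈-consecutive⁻ e∈) e∈′))
             (key p′∈ p∈ (p≢p′ ∘ sym) e∈′ (∈-consecutive⁻ e∈)))
    where
    e∈′ : e₁ ∈ branchPath p′ × e₂ ∈ branchPath p′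
    e∈′ with edgeKey-injective (e₁ , e₂) e′ eq | ∈-consecutive⁻ e′∈
    ... | inj₁ (refl , refl) | e′₁∈ , e′₂∈ = e′₁∈ , e′₂∈
    ... | inj₂ (refl , refl) | e′₁∈ , e′₂∈ = e′₂∈ , e′₁∈
    e₁≢e₂ : e₁ ≢ e₂
    e₁≢e₂ = Unique⇒consecutive-≢ (Unique-branchPath p∈) e∈
    key : ∀ {q q′} → q ∈ pairs t → q′ ∈ pairs t → q ≢ q′ →
          e₁ ∈ branchPath q × e₂ ∈ branchPath q → e₁ ∈ branchPath q′ × e₂ ∈ branchPath q′ →
          edgeKey (e₁ , e₂) ≡ edgeKey (ends q)
    key q∈ q′∈ q≢q′ (e₁∈ , e₂∈) (e₁∈′ , e₂∈′) =
      edgeKey-within e₁≢e₂ (branchPaths-meetAtEnds q∈ q′∈ q≢q′ e₁∈ e₁∈′)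
                           (branchPaths-meetAtEnds q∈ q′∈ q≢q′ e₂∈ e₂∈′)

  -- Distinct branch paths could only share an edge joining the ends of both, which i < j rules out.
  branchPaths-edgeDisjoint : ∀ {p p′ e e′} → p ∈ pairs t → p′ ∈ pairs t →
                             e ∈ consecutive (branchPath p) → e′ ∈ consecutive (branchPath p′) →
                             edgeKey e ≡ edgeKey e′ → p ≡ p′
  branchPaths-edgeDisjoint {p} {p′} p∈ p′∈ e∈ e′∈ eq with ≡-dec Fin._≟_ Fin._≟_ p p′
  ... | yes p≡p′ = p≡p′
  ... | no p≢p′ with sharedEdge⇒sameEnds p∈ p′∈ p≢p′ e∈ e′∈ eq
  ...   | inj₁ (i≡i′ , j≡j′) = ⊥-elim (p≢p′ (cong₂ _,_ (φ-injective i≡i′) (φ-injective j≡j′)))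
  ...   | inj₂ (i≡j′ , j≡i′) =
    ⊥-elim (Fin.<-asym (∈-pairs⁻ p∈) (subst₂ Fin._<_ (sym (φ-injective j≡i′)) (sym (φ-injective i≡j′))
                                                     (∈-pairs⁻ p′∈)))

-- The bipartite subgraph

module Bipartition {G : Graph} {s : ℕ} (M : TopMinorK s G) where
  open TopMinorK M

  pathParity : Fin s → Fin s → Bool
  pathParity i j = odd (suc (length (P i j)))

  branchColour : Fin s → Bool
  branchColour = proj₁ (halfSatisfiable s pathParity)

  consistent : Fin s → Fin s → Bool
  consistent = satisfied branchColour pathParity

  F : Graph
  F = pairGraph consistent

  triangular≤degreeSum-F : triangular s ℕ.≤ degreeSum F
  triangular≤degreeSum-F =
    subst (triangular s ℕ.≤_) (sym (trans (degreeSum-pairGraph consistent) (n+n≡2*n (upperCount consistent))))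
          (proj₂ (halfSatisfiable s pathParity))

  -- A vertex of the subdivision is a branch vertex, or the m-th interior vertex of the path P i j.
  Interior : Set
  Interior = (Fin s × Fin s) × ℕ

  Label : Set
  Label = Fin s ⊎ Interior

  vertex : Label → Fin (n G)
  vertex (inj₁ k)               = φ k
  vertex (inj₂ ((i , j) , m)) = nthOr (φ i) (P i j) m

  interiorLabels : Fin s × Fin s → List Interior
  interiorLabels p = map (p ,_) (upTo (length (uncurry P p)))

  labels : List Label
  labels = map inj₁ (allFin s) ++ map inj₂ (concatMap interiorLabels (pairs s))

  map-vertex-labels : map vertex labels ≡ map φ (allFin s) ++ interiors P
  map-vertex-labels = begin
    map vertex labels
      ≡⟨ List.map-++ vertex (map inj₁ (allFin s)) _ ⟩
    map vertex (map inj₁ (allFin s)) ++ map vertex (map inj₂ (concatMap interiorLabels (pairs s)))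
      ≡⟨ cong₂ _++_ (sym (List.map-∘ (allFin s))) (sym (List.map-∘ (concatMap interiorLabels (pairs s)))) ⟩
    map φ (allFin s) ++ map (vertex ∘ inj₂) (concatMap interiorLabels (pairs s))
      ≡⟨ cong (map φ (allFin s) ++_) (List.map-concatMap (vertex ∘ inj₂) interiorLabels (pairs s)) ⟩
    map φ (allFin s) ++ concatMap (map (vertex ∘ inj₂) ∘ interiorLabels) (pairs s)
      ≡⟨ cong (map φ (allFin s) ++_) (List.concatMap-cong interiorVertices (pairs s)) ⟩
    map φ (allFin s) ++ concatMap (uncurry P) (pairs s)
      ≡⟨ cong (map φ (allFin s) ++_) (interiors-pairs P) ⟨
    map φ (allFin s) ++ interiors P ∎
    where
    open ≡-Reasoning
    interiorVertices : ∀ p → map (vertex ∘ inj₂) (interiorLabels p) ≡ uncurry P p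
    interiorVertices (i , j) = trans (sym (List.map-∘ (upTo (length (P i j))))) (map-nthOr-upTo (φ i) (P i j))

  Unique-map-vertex-labels : Unique (map vertex labels)
  Unique-map-vertex-labels = subst Unique (sym map-vertex-labels) distinct

  branch∈labels : ∀ k → inj₁ k ∈ labels
  branch∈labels k = ∈-++⁺ˡ (∈-map⁺ inj₁ (∈-allFin k))

  interior∈labels : ∀ {i j m} → i Fin.< j → m ℕ.< length (P i j) → inj₂ ((i , j) , m) ∈ labels
  interior∈labels i<j m< = ∈-++⁺ʳ (map inj₁ (allFin s))
    (∈-map⁺ inj₂ (∈-concatMap⁺ (∈-pairs⁺ i<j) (∈-map⁺ _ (∈-upTo⁺ m<))))

  labelColour : Label → Bool
  labelColour (inj₁ k)               = branchColour k
  labelColour (inj₂ ((i , j) , m)) = branchColour i xor odd (suc m)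

  colour : Fin (n G) → Bool
  colour y = maybe labelColour false (preimage Fin._≟_ vertex labels y)

  colour-vertex : ∀ {l} → l ∈ labels → colour (vertex l) ≡ labelColour l
  colour-vertex l∈ =
    cong (maybe labelColour false) (preimage-correct Fin._≟_ vertex labels Unique-map-vertex-labels l∈)

  Ĝ : Graph
  Ĝ = crossingSubgraph G colour

  forwardWalk : ∀ {i j} → i Fin.< j → consistent i j ≡ true → Walk Ĝ (φ i) (P i j) (φ j)
  forwardWalk {i} {j} i<j ij-consistent =
    Walk-crossing G colour (φ i) (P i j) κ alternating (walks i j i<j)
      (trans (colour-vertex (branch∈labels i)) (sym (Bool.xor-identityʳ _)))
      (λ m m< → colour-vertex (interior∈labels i<j m<))
      (trans (colour-vertex (branch∈labels j)) (==⇒≡ ij-consistent))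
    where
    κ : ℕ → Bool
    κ m = branchColour i xor odd m
    alternating : Alternating κ
    alternating m = sym (Bool.not-distribʳ-xor (branchColour i) (odd m))

  -- The interior of the path of Ĝ standing for the edge ij of F: P i j, or P j i traversed backwards.
  segment : Fin s → Fin s → List Interior
  segment i j = if i <ᵇ j then map ((i , j) ,_) (upTo (length (P i j)))
                          else map ((j , i) ,_) (downFrom (length (P j i)))

  segment-walk : ∀ i j → adj F i j ≡ true → Walk Ĝ (φ i) (map (vertex ∘ inj₂) (segment i j)) (φ j)
  segment-walk i j ij∈F with i <ᵇ j in i<ᵇj
  ... | true = subst (λ xs → Walk Ĝ (φ i) xs (φ j)) (sym forwardVertices) (forwardWalk (<ᵇ⇒< i j i<ᵇj) ij∈F)
    where
    forwardVertices : map (vertex ∘ inj₂) (map ((i , j) ,_) (upTo (length (P i j)))) ≡ P i j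
    forwardVertices = trans (sym (List.map-∘ (upTo (length (P i j))))) (map-nthOr-upTo (φ i) (P i j))
  ... | false with j <ᵇ i in j<ᵇi
  ...   | true  = subst (λ xs → Walk Ĝ (φ i) xs (φ j)) (sym backwardVertices)
                    (Walk-reverse Ĝ (P j i) (forwardWalk (<ᵇ⇒< j i j<ᵇi) ij∈F))
    where
    backwardVertices : map (vertex ∘ inj₂) (map ((j , i) ,_) (downFrom (length (P j i)))) ≡ reverse (P j i)
    backwardVertices = trans (sym (List.map-∘ (downFrom (length (P j i))))) (map-nthOr-downFrom (φ j) (P j i))
  ...   | false with () ← ij∈F

  segment-key : ∀ i j {r} → r ∈ segment i j → proj₁ r ≡ edgeKey (i , j)
  segment-key i j r∈ with i <ᵇ j
  ... | true  with _ , _ , refl ← ∈-map⁻ _ r∈ = refl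
  ... | false with _ , _ , refl ← ∈-map⁻ _ r∈ = refl

  Unique-segment : ∀ i j → Unique (segment i j)
  Unique-segment i j with i <ᵇ j
  ... | true  = Unique.map⁺ (cong proj₂) (Unique.upTo⁺ _)
  ... | false = Unique.map⁺ (cong proj₂) (Unique.downFrom⁺ _)

  segment⊆labels : ∀ i j → i ≢ j → ∀ {r} → r ∈ segment i j → inj₂ r ∈ labels
  segment⊆labels i j i≢j r∈ with i <ᵇ j in i<ᵇj
  ... | true  with _ , m∈ , refl ← ∈-map⁻ _ r∈ = interior∈labels (<ᵇ⇒< i j i<ᵇj) (∈-upTo⁻ m∈)
  ... | false with j <ᵇ i in j<ᵇi
  ...   | true  with _ , m∈ , refl ← ∈-map⁻ _ r∈ = interior∈labels (<ᵇ⇒< j i j<ᵇi) (∈-downFrom⁻ m∈)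
  ...   | false = ⊥-elim (i≢j (<ᵇ-connex i j i<ᵇj j<ᵇi))

  liftPath : Fin s → List (Fin s) → Fin s → List Label
  liftPath i []       j = map inj₂ (segment i j)
  liftPath i (k ∷ ks) j = map inj₂ (segment i k) ++ inj₁ k ∷ liftPath k ks j

  lefts-liftPath : ∀ i ks j → lefts (liftPath i ks j) ≡ ks
  lefts-liftPath i []       j = lefts-map-inj₂ (segment i j)
  lefts-liftPath i (k ∷ ks) j =
    trans (lefts-++ (map inj₂ (segment i k)) _)
          (cong₂ _++_ (lefts-map-inj₂ (segment i k)) (cong (k ∷_) (lefts-liftPath k ks j)))

  rights-liftPath : ∀ i ks j →
                    rights (liftPath i ks j) ≡ concatMap (uncurry segment) (consecutive (i ∷ ks ++ [ j ]))
  rights-liftPath i []       j = trans (rights-map-inj₂ (segment i j)) (sym (List.++-identityʳ (segment i j)))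
  rights-liftPath i (k ∷ ks) j =
    trans (rights-++ (map inj₂ (segment i k)) _)
          (cong₂ _++_ (rights-map-inj₂ (segment i k)) (rights-liftPath k ks j))

  Walk-liftPath : ∀ i ks j → Walk F i ks j → Walk Ĝ (φ i) (map vertex (liftPath i ks j)) (φ j)
  Walk-liftPath i []       j ij       = subst (λ xs → Walk Ĝ (φ i) xs (φ j)) (List.map-∘ (segment i j))
                                          (segment-walk i j ij)
  Walk-liftPath i (k ∷ ks) j (ik , w) =
    subst (λ xs → Walk Ĝ (φ i) xs (φ j)) (sym (trans (List.map-++ vertex (map inj₂ (segment i k)) _)
                                                     (cong (_++ _) (sym (List.map-∘ (segment i k))))))
      (Walk-++ Ĝ _ _ (segment-walk i k ik) (Walk-liftPath k ks j w))

  module _ {t : ℕ} (K : TopMinorK t F) where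
    open TopMinorK K renaming (φ to ψ; P to Q; walks to Q-walks)
    open BranchPaths K

    liftedPath : Fin t × Fin t → List Label
    liftedPath p = liftPath (ψ (proj₁ p)) (uncurry Q p) (ψ (proj₂ p))

    liftedLabels : List Label
    liftedLabels = map inj₁ (map ψ (allFin t)) ++ concatMap liftedPath (pairs t)

    lefts-liftedLabels : lefts liftedLabels ≡ map ψ (allFin t) ++ concatMap (uncurry Q) (pairs t)
    lefts-liftedLabels =
      trans (lefts-++ (map inj₁ (map ψ (allFin t))) _)
            (cong₂ _++_ (lefts-map-inj₁ _)
                        (trans (lefts-concatMap liftedPath (pairs t))
                               (List.concatMap-cong (λ p → lefts-liftPath _ (uncurry Q p) _) (pairs t))))

    rights-liftedLabels : rights liftedLabels ≡
                          concatMap (λ p → concatMap (uncurry segment) (consecutive (branchPath p))) (pairs t)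
    rights-liftedLabels =
      trans (rights-++ (map inj₁ (map ψ (allFin t))) _)
            (cong₂ _++_ (rights-map-inj₁ (map ψ (allFin t)))
                        (trans (rights-concatMap liftedPath (pairs t))
                               (List.concatMap-cong (λ p → rights-liftPath _ (uncurry Q p) _) (pairs t))))

    -- No edge of F is used twice, and the segments of distinct edges of F have distinct labels.
    Unique-rights-liftedLabels : Unique (rights liftedLabels)
    Unique-rights-liftedLabels = subst Unique (sym rights-liftedLabels)
      (Unique-concatMap⁺ (Unique-pairs t) Unique-block
        λ p∈ p′∈ p≢p′ (r∈ , r∈′) → p≢p′ (sameBranchPath p∈ p′∈ r∈ r∈′))
      where
      keyOf : ∀ {e r} → r ∈ uncurry segment e → proj₁ r ≡ edgeKey e
      keyOf {e} = segment-key (proj₁ e) (proj₂ e)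

      Unique-block : ∀ {p} → p ∈ pairs t → Unique (concatMap (uncurry segment) (consecutive (branchPath p)))
      Unique-block {p} p∈ =
        Unique-concatMap⁺ (Unique.map⁻ edgeKeys-unique) (λ {e} _ → Unique-segment (proj₁ e) (proj₂ e))
          λ e∈ e′∈ e≢e′ (r∈ , r∈′) →
            e≢e′ (Unique-map⇒injectiveOn edgeKeys-unique e∈ e′∈ (trans (sym (keyOf r∈)) (keyOf r∈′)))
        where
        edgeKeys-unique : Unique (map edgeKey (consecutive (branchPath p)))
        edgeKeys-unique = Unique-edgeKeys (Unique-branchPath p∈)

      sameBranchPath : ∀ {p p′ r} → p ∈ pairs t → p′ ∈ pairs t →
                       r ∈ concatMap (uncurry segment) (consecutive (branchPath p)) →
                       r ∈ concatMap (uncurry segment) (consecutive (branchPath p′)) → p ≡ p′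
      sameBranchPath {p} {p′} p∈ p′∈ r∈ r∈′
        with e , e∈ , r∈e ← ∈-concatMap⁻ (consecutive (branchPath p)) r∈
        with e′ , e′∈ , r∈e′ ← ∈-concatMap⁻ (consecutive (branchPath p′)) r∈′
        = branchPaths-edgeDisjoint p∈ p′∈ e∈ e′∈ (trans (sym (keyOf r∈e)) (keyOf r∈e′))

    Unique-liftedLabels : Unique liftedLabels
    Unique-liftedLabels = Unique-lefts-rights⇒Unique (subst Unique (sym lefts-liftedLabels) Unique-vertices)
                                                     Unique-rights-liftedLabels

    liftedLabels⊆labels : liftedLabels ⊆ labels
    liftedLabels⊆labels {inj₁ k} _  = branch∈labels k
    liftedLabels⊆labels {inj₂ r} l∈
      with p , p∈ , r∈ ← ∈-concatMap⁻ (pairs t) (subst (r ∈_) rights-liftedLabels (∈-rights l∈))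
      with (u , v) , e∈ , r∈uv ← ∈-concatMap⁻ (consecutive (branchPath p)) r∈
      = segment⊆labels u v (Unique⇒consecutive-≢ (Unique-branchPath p∈) e∈) r∈uv

    liftTopMinor : TopMinorK t Ĝ
    liftTopMinor = record
      { φ        = φ ∘ ψ
      ; P        = liftedInterior
      ; walks    = λ i j i<j → Walk-liftPath (ψ i) (Q i j) (ψ j) (Q-walks i j i<j)
      ; distinct = subst Unique (sym vertices≡)
                     (Unique-map⁺-⊆ Unique-map-vertex-labels liftedLabels⊆labels Unique-liftedLabels)
      }
      where
      liftedInterior : Fin t → Fin t → List (Fin (n G))
      liftedInterior i j = map vertex (liftedPath (i , j))

      vertices≡ : map (φ ∘ ψ) (allFin t) ++ interiors liftedInterior ≡ map vertex liftedLabels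
      vertices≡ = begin
        map (φ ∘ ψ) (allFin t) ++ interiors liftedInterior
          ≡⟨ cong₂ _++_ (trans (List.map-∘ (allFin t)) (List.map-∘ (map ψ (allFin t))))
                        (trans (interiors-pairs liftedInterior)
                               (sym (List.map-concatMap vertex liftedPath (pairs t)))) ⟩
        map vertex (map inj₁ (map ψ (allFin t))) ++ map vertex (concatMap liftedPath (pairs t))
          ≡⟨ List.map-++ vertex (map inj₁ (map ψ (allFin t))) _ ⟨
        map vertex liftedLabels ∎
        where open ≡-Reasoning

-- Rational arithmetic

ℕ→ℚ≡mkℚ : ∀ m → ℕ→ℚ m ≡ mkℚ (+ m) 0 (Coprime.sym (Coprime.1-coprimeTo m))
ℕ→ℚ≡mkℚ m = ℚ.normalize-coprime (Coprime.sym (Coprime.1-coprimeTo m))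

ℕ→ℚ-+ : ∀ m k → ℕ→ℚ (m ℕ.+ k) ≡ ℕ→ℚ m + ℕ→ℚ k
ℕ→ℚ-+ m k = trans (ℚ./-cong {q₁ = 1} {q₂ = 1} numerator refl)
                  (sym (cong₂ _+_ (ℕ→ℚ≡mkℚ m) (ℕ→ℚ≡mkℚ k)))
  where
  numerator : + (m ℕ.+ k) ≡ + m ℤ.* + 1 ℤ.+ + k ℤ.* + 1
  numerator = trans (ℤ.pos-+ m k) (sym (cong₂ ℤ._+_ (ℤ.*-identityʳ (+ m)) (ℤ.*-identityʳ (+ k))))

ℕ→ℚ-mono-≤ : ∀ {m k} → m ℕ.≤ k → ℕ→ℚ m ≤ ℕ→ℚ k
ℕ→ℚ-mono-≤ {m} {k} m≤k rewrite ℕ→ℚ≡mkℚ m | ℕ→ℚ≡mkℚ k =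
  *≤* (subst₂ ℤ._≤_ (sym (ℤ.*-identityʳ (+ m))) (sym (ℤ.*-identityʳ (+ k))) (ℤ.+≤+ m≤k))

ℕ→ℚ-nonNeg : ∀ m → 0ℚ ≤ ℕ→ℚ m
ℕ→ℚ-nonNeg m = ℕ→ℚ-mono-≤ {0} {m} z≤n

p≤∣p∣ : ∀ p → p ≤ ∣ p ∣
p≤∣p∣ (mkℚ (+ _)     _ _) = ℚ.≤-refl
p≤∣p∣ (mkℚ -[1+ _ ] _ _) = ℚ.<⇒≤ (ℚ.neg<pos _ _)

nonNeg-* : ∀ {p q} → 0ℚ ≤ p → 0ℚ ≤ q → 0ℚ ≤ p * q
nonNeg-* {p} {q} p≥0 q≥0 =
  ℚ.nonNegative⁻¹ (p * q) {{ℚ.nonNeg*nonNeg⇒nonNeg p {{nonNegative p≥0}} q {{nonNegative q≥0}}}}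

two : ℚ
two = ℕ→ℚ 2

two*-mono-≤ : ∀ {p q} → p ≤ q → two * p ≤ two * q
two*-mono-≤ = ℚ.*-monoˡ-≤-nonNeg two {{nonNegative (ℕ→ℚ-nonNeg 2)}}

triangular-ℚ : ∀ s → ℕ→ℚ (triangular s) * two ≡ ℕ→ℚ s * (ℕ→ℚ s - 1ℚ)
triangular-ℚ zero    = refl
triangular-ℚ (suc s) = begin
  ℕ→ℚ (s ℕ.+ triangular s) * two          ≡⟨ cong (_* two) (ℕ→ℚ-+ s (triangular s)) ⟩
  (S + ℕ→ℚ (triangular s)) * two          ≡⟨ ℚ.*-distribʳ-+ two S (ℕ→ℚ (triangular s)) ⟩
  S * two + ℕ→ℚ (triangular s) * two      ≡⟨ cong (_+_ (S * two)) (triangular-ℚ s) ⟩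
  S * two + S * (S - 1ℚ)                  ≡⟨ solve 1 (λ S → S :* con two :+ S :* (S :- con 1ℚ)
                                                         := (con 1ℚ :+ S) :* ((con 1ℚ :+ S) :- con 1ℚ)) refl S ⟩
  (1ℚ + S) * ((1ℚ + S) - 1ℚ)              ≡⟨ cong (λ x → x * (x - 1ℚ)) (ℕ→ℚ-+ 1 s) ⟨
  ℕ→ℚ (suc s) * (ℕ→ℚ (suc s) - 1ℚ)        ∎
  where
  open ≡-Reasoning
  open +-*-Solver
  S : ℚ
  S = ℕ→ℚ s

-- K_s with at least half of its edges has average degree at least (s - 1)/2.
halfDensity : ∀ K s → two * K + two ≤ ℕ→ℚ s → (K + ½) * ℕ→ℚ s ≤ ℕ→ℚ (triangular s)
halfDensity K s bound = ℚ.*-cancelʳ-≤-pos two (begin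
  (K + ½) * S * two          ≡⟨ solve 2 (λ K S → (K :+ con ½) :* S :* con two
                                                := (con two :* K :+ con two :- con 1ℚ) :* S) refl K S ⟩
  (two * K + two - 1ℚ) * S   ≤⟨ ℚ.*-monoʳ-≤-nonNeg S {{nonNegative (ℕ→ℚ-nonNeg s)}}
                                                   (ℚ.+-monoˡ-≤ (- 1ℚ) bound) ⟩
  (S - 1ℚ) * S               ≡⟨ ℚ.*-comm (S - 1ℚ) S ⟩
  S * (S - 1ℚ)               ≡⟨ triangular-ℚ s ⟨
  ℕ→ℚ (triangular s) * two   ∎)
  where
  open ℚ.≤-Reasoning
  open +-*-Solver
  S : ℚ
  S = ℕ→ℚ s

densityThreshold : ∀ {c a ε T} s → 0ℚ < c → 0ℚ ≤ a → 0ℚ ≤ T → two ≤ ε * T →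
                   ((two * c) + (two * a + ε)) * T ≤ ℕ→ℚ s →
                   1 ℕ.≤ s × ((c + a) * T + ½) * ℕ→ℚ s ≤ ℕ→ℚ (triangular s)
densityThreshold {c} {a} {ε} {T} s c>0 a≥0 T≥0 two≤εT bound = 1≤s s 2K+2≤s , halfDensity K s 2K+2≤s
  where
  open ℚ.≤-Reasoning
  open +-*-Solver
  K : ℚ
  K = (c + a) * T
  2K+2≤s : two * K + two ≤ ℕ→ℚ s
  2K+2≤s = begin
    two * K + two                    ≤⟨ ℚ.+-monoʳ-≤ (two * K) two≤εT ⟩
    two * K + ε * T                  ≡⟨ solve 4 (λ c a ε T → con two :* ((c :+ a) :* T) :+ ε :* T
                                                   := ((con two :* c) :+ (con two :* a :+ ε)) :* T) refl c a ε T ⟩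
    ((two * c) + (two * a + ε)) * T  ≤⟨ bound ⟩
    ℕ→ℚ s                            ∎
  K≥0 : 0ℚ ≤ K
  K≥0 = nonNeg-* (ℚ.<⇒≤ (ℚ.+-mono-<-≤ c>0 a≥0)) T≥0
  1≤s : ∀ s → two * K + two ≤ ℕ→ℚ s → 1 ℕ.≤ s
  1≤s (suc _) _      = s≤s z≤n
  1≤s zero    2K+2≤0 = ⊥-elim (ℚ.<-irrefl refl (begin-strict
    0ℚ             <⟨ ℚ.+-mono-≤-< (nonNeg-* (ℕ→ℚ-nonNeg 2) K≥0) (ℚ.positive⁻¹ two) ⟩
    two * K + two  ≤⟨ 2K+2≤0 ⟩
    0ℚ             ∎))

<-∣∣-threshold : ∀ c x {T} → 0ℚ ≤ T → (c + x) * T < (c + ∣ x ∣) * T + ½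
<-∣∣-threshold c x {T} T≥0 = begin-strict
  (c + x) * T            ≤⟨ ℚ.*-monoʳ-≤-nonNeg T {{nonNegative T≥0}} (ℚ.+-monoʳ-≤ c (p≤∣p∣ x)) ⟩
  (c + ∣ x ∣) * T        ≡⟨ ℚ.+-identityʳ _ ⟨
  (c + ∣ x ∣) * T + 0ℚ   <⟨ ℚ.+-monoʳ-< ((c + ∣ x ∣) * T) (ℚ.positive⁻¹ ½) ⟩
  (c + ∣ x ∣) * T + ½    ∎
  where open ℚ.≤-Reasoning

inverseSuc : ℕ → ℚ
inverseSuc k = mkℚ (+ 1) k (Coprime.1-coprimeTo (suc k))

inverseSuc-* : ∀ k → inverseSuc k * ℕ→ℚ (suc k) ≡ 1ℚ
inverseSuc-* k = trans (cong (inverseSuc k *_) (ℕ→ℚ≡mkℚ (suc k)))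
                       (ℚ.*-inverseˡ (mkℚ (+ suc k) 0 (Coprime.sym (Coprime.1-coprimeTo (suc k)))))

inverseSuc-nonNeg : ∀ k → 0ℚ ≤ inverseSuc k
inverseSuc-nonNeg k = ℚ.<⇒≤ (ℚ.positive⁻¹ (inverseSuc k))

inverseSuc-antitone : ∀ {q k} → q ℕ.≤ k → inverseSuc k ≤ inverseSuc q
inverseSuc-antitone {q} {k} q≤k =
  *≤* (subst₂ ℤ._≤_ (sym (ℤ.*-identityˡ (+ suc q))) (sym (ℤ.*-identityˡ (+ suc k)))
                    (ℤ.+≤+ (s≤s q≤k)))

archimedean : ∀ e → 0ℚ < e → ∃[ q ] inverseSuc q ≤ e
archimedean (mkℚ (+ suc p) q _) _   =
  q , *≤* (ℤ.*-monoʳ-≤-nonNeg (+ suc q) (ℤ.+≤+ {1} {suc p} (s≤s z≤n)))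
archimedean (mkℚ (+ zero)  q _) e>0 = ⊥-elim (ℤ.<-irrefl refl (ℚ.drop-*<* e>0))
archimedean (mkℚ -[1+ p ]  q _) e>0 = ⊥-elim (ℚ.<-asym e>0 (ℚ.negative⁻¹ _))

-- slack t = 2/t makes slack t · t² ≥ 2, which pays for the "+ two" in densityThreshold.
slack : ℕ → ℚ
slack zero    = 0ℚ
slack (suc k) = two * inverseSuc k

two≤slack*t² : ∀ k → two ≤ slack (suc k) * (ℕ→ℚ (suc k) * ℕ→ℚ (suc k))
two≤slack*t² k = begin
  two                           ≡⟨ ℚ.*-identityʳ two ⟨
  two * 1ℚ                      ≤⟨ two*-mono-≤ (ℕ→ℚ-mono-≤ {1} {suc k} (s≤s z≤n)) ⟩
  two * t                       ≡⟨ cong (λ x → two * x * t) (inverseSuc-* k) ⟨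
  two * (inverseSuc k * t) * t  ≡⟨ solve 3 (λ x i t → x :* (i :* t) :* t := x :* i :* (t :* t))
                                           refl two (inverseSuc k) t ⟩
  slack (suc k) * (t * t)       ∎
  where
  open ℚ.≤-Reasoning
  open +-*-Solver
  t : ℚ
  t = ℕ→ℚ (suc k)

errorTerm : (ℕ → ℚ) → ℕ → ℚ
errorTerm h t = two * ∣ h t ∣ + slack t

errorTerm-nonNeg : ∀ h t → 0ℚ ≤ errorTerm h t
errorTerm-nonNeg h t = ℚ.+-mono-≤ (nonNeg-* (ℕ→ℚ-nonNeg 2) (ℚ.0≤∣p∣ (h t))) (slack-nonNeg t)
  where
  slack-nonNeg : ∀ t → 0ℚ ≤ slack t
  slack-nonNeg zero    = ℚ.≤-refl
  slack-nonNeg (suc k) = nonNeg-* (ℕ→ℚ-nonNeg 2) (inverseSuc-nonNeg k)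

errorTerm→0 : ∀ h → TendsToZero h → TendsToZero (errorTerm h)
errorTerm→0 h h→0 e e>0 = combine (archimedean e/4 e/4>0) (h→0 e/4 e/4>0)
  where
  e/4 : ℚ
  e/4 = e * ½ * ½
  e/4>0 : 0ℚ < e/4
  e/4>0 = ℚ.*-monoˡ-<-pos ½ (ℚ.*-monoˡ-<-pos ½ e>0)
  combine : ∃[ q ] inverseSuc q ≤ e/4 → ∃[ N ] (∀ t → N ℕ.≤ t → ∣ h t ∣ ≤ e/4) →
            ∃[ N ] (∀ t → N ℕ.≤ t → ∣ errorTerm h t ∣ ≤ e)
  combine (q , inverseSuc-q≤e/4) (N , ∣h∣≤e/4) = N ℕ.⊔ suc q , bound
    where
    bound : ∀ t → N ℕ.⊔ suc q ℕ.≤ t → ∣ errorTerm h t ∣ ≤ e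
    bound zero    N⊔q<0 = ⊥-elim (ℕ.<⇒≱ (s≤s z≤n) (ℕ.≤-trans (ℕ.m≤n⊔m N (suc q)) N⊔q<0))
    bound (suc k) N⊔q≤t = begin
      ∣ errorTerm h t ∣                       ≡⟨ ℚ.0≤p⇒∣p∣≡p (errorTerm-nonNeg h t) ⟩
      two * ∣ h t ∣ + two * inverseSuc k      ≤⟨ ℚ.+-mono-≤ (two*-mono-≤ (∣h∣≤e/4 t N≤t))
                                                            (two*-mono-≤ (ℚ.≤-trans (inverseSuc-antitone q≤k)
                                                                                    inverseSuc-q≤e/4)) ⟩
      two * (e * ½ * ½) + two * (e * ½ * ½)   ≡⟨ solve 1 (λ e → con two :* (e :* con ½ :* con ½)
                                                               :+ con two :* (e :* con ½ :* con ½) := e) refl e ⟩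
      e                                       ∎
      where
      open ℚ.≤-Reasoning
      open +-*-Solver
      t : ℕ
      t = suc k
      N≤t : N ℕ.≤ t
      N≤t = ℕ.≤-trans (ℕ.m≤m⊔n N (suc q)) N⊔q≤t
      q≤k : q ℕ.≤ k
      q≤k = ℕ.≤-pred (ℕ.≤-trans (ℕ.m≤n⊔m N (suc q)) N⊔q≤t)

mainTheorem6 : (c : ℚ) → 0ℚ < c →
    (∃[ h ] (TendsToZero h ×
       (∀ (t : ℕ) → 1 ℕ.≤ t → ftildeKAtMost t ((c + h t) * (ℕ→ℚ t * ℕ→ℚ t))))) →
    ∃[ g ] (TendsToZero g ×
       (∀ (t : ℕ) → 1 ℕ.≤ t → ∀ (G : Graph) →
          HajosAtLeast G (((ℕ→ℚ 2 * c) + g t) * (ℕ→ℚ t * ℕ→ℚ t)) →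
          ∃[ Ĝ ] (BipartiteSubgraph G Ĝ × HajosAtLeast Ĝ (ℕ→ℚ t))))
mainTheorem6 c c>0 (h , h→0 , f̃[Kₜ]≤) = errorTerm h , errorTerm→0 h h→0 , bipartiteTopMinor
  where
  bipartiteTopMinor : ∀ t → 1 ℕ.≤ t → ∀ G →
                      HajosAtLeast G (((two * c) + errorTerm h t) * (ℕ→ℚ t * ℕ→ℚ t)) →
                      ∃[ Ĝ ] (BipartiteSubgraph G Ĝ × HajosAtLeast Ĝ (ℕ→ℚ t))
  bipartiteTopMinor t@(suc k) 1≤t G (s , Kₛ , bound) =
    Ĝ , crossingSubgraph-bipartite G colour , t , liftTopMinor (f̃[Kₜ]≤ t 1≤t d (<-∣∣-threshold c (h t) T≥0) F F-dense) , ℚ.≤-refl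
    where
    open Bipartition Kₛ
    T d : ℚ
    T = ℕ→ℚ t * ℕ→ℚ t
    d = (c + ∣ h t ∣) * T + ½
    T≥0 : 0ℚ ≤ T
    T≥0 = nonNeg-* (ℕ→ℚ-nonNeg t) (ℕ→ℚ-nonNeg t)
    threshold : 1 ℕ.≤ s × d * ℕ→ℚ s ≤ ℕ→ℚ (triangular s)
    threshold = densityThreshold s c>0 (ℚ.0≤∣p∣ (h t)) T≥0 (two≤slack*t² k) bound
    F-dense : AvgDegAtLeast F d
    F-dense = proj₁ threshold , ℚ.≤-trans (proj₂ threshold) (ℕ→ℚ-mono-≤ triangular≤degreeSum-F)
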